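{- Let $I$ be an instance of SMTI with set of children $C$ and set of families $F$. Let $i \in C$ be a child and let $\mathcal{F} \subseteq F$ be a nonempty set of families such that $(i,j)$ is an acceptable pair for every $j \in \mathcal{F}$. Let $$\mathcal{C} = \bigcup_{j \in \mathcal{F}} T_j(i), \qquad \text{where } T_j(i) = \{ i' \in C : (i',j) \text{ is acceptable and } \mathrm{rank}'_j(i') \le \mathrm{rank}'_j(i)\},$$ i.e. $\mathcal{C}$ is the set of children that at least one family in $\mathcal{F}$ ranks at the same level as or better than $i$. If $|\mathcal{F}| \ge |\mathcal{C}|$, then in every stable matching $M$ of $I$, child $i$ is matched with some family $j'$ satisfying $\mathrm{rank}_i(j') \le \max_{j \in \mathcal{F}} \mathrm{rank}_i(j)$.
   Context: An instance of SMTI (Stable Marriage with Ties and Incomplete lists) consists of a finite set $C$ of children and a finite set $F$ of families; each child ranks a subset of the families (those it finds acceptable) in order of preference, possibly with ties, and each family similarly ranks a subset of the children. Preference lists are consistent: a child $c$ finds a family $f$ acceptable iff $f$ finds $c$ acceptable, in which case $(c,f)$ is an acceptable pair. For a child $i$ and acceptable family $j$, $\mathrm{rank}_i(j)$ is the integer $k$ such that $j$ lies in the $k$-th most preferred tie of $i$'s list (smaller is better); analogously $\mathrm{rank}'_j(i)$ is the rank of child $i$ in family $j$'s list. An agent prefers $a$ to $b$ iff $a$ has strictly smaller rank than $b$ in its list. A matching $M$ is a set of acceptable pairs in which each agent appears at most once; $M(a)$ denotes the partner of a matched agent $a$. A pair $(c,f) \notin M$ blocks $M$ if $(c,f)$ is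 acceptable, $c$ is unmatched or prefers $f$ to $M(c)$, and $f$ is unmatched or prefers $c$ to $M(f)$. $M$ is stable if no pair blocks it. -}

module Defs where

open import Data.Nat using (ℕ; zero; suc; _≤_; _<_; _⊔_)
open import Data.Bool using (Bool; true; false; if_then_else_)
open import Data.Fin using (Fin; zero; suc)
open import Data.Fin.Subset using (Subset)
open import Data.Vec using ([]; _∷_)
open import Data.Maybe using (Maybe; just; nothing)
open import Data.Product using (Σ; ∃; _×_; _,_)
open import Data.Sum using (_⊎_)
open import Relation.Binary.PropositionalEquality using (_≡_; _≢_)
open import Relation.Nullary using (¬_)

-- An SMTI instance with children Fin nC and families Fin nF.
-- 'acc c f' says that (c , f) is an acceptable pair (a single relation, so
-- preference lists are automatically consistent).
-- 'crank c f' = rank_c(f), 'frank f c' = rank'_f(c); only meaningful on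
-- acceptable pairs.  Ranks are tie-levels: they start at 1 and are dense
-- (if some acceptable partner is in tie k+1, some acceptable partner is in
-- tie k), i.e. exactly the "k-th most preferred tie" of the preference list.
record SMTI (nC nF : ℕ) : Set where
  field
    acc   : Fin nC → Fin nF → Bool
    crank : Fin nC → Fin nF → ℕ
    frank : Fin nF → Fin nC → ℕ
    crank-pos   : ∀ c f → acc c f ≡ true → 1 ≤ crank c f
    frank-pos   : ∀ f c → acc c f ≡ true → 1 ≤ frank f c
    crank-dense : ∀ c f k → acc c f ≡ true → crank c f ≡ suc (suc k) →
                  ∃ λ f' → acc c f' ≡ true × crank c f' ≡ suc k
    frank-dense : ∀ f c k → acc c f ≡ true → frank f c ≡ suc (suc k) →
                  ∃ λ c' → acc c' f ≡ true × frank f c' ≡ suc k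

open SMTI public

Matching : ℕ → ℕ → Set
Matching nC nF = Fin nC → Maybe (Fin nF)

IsMatching : ∀ {nC nF} → SMTI nC nF → Matching nC nF → Set
IsMatching I M =
  (∀ c f → M c ≡ just f → acc I c f ≡ true) ×
  (∀ c c' f → M c ≡ just f → M c' ≡ just f → c ≡ c')

Blocks : ∀ {nC nF} → SMTI nC nF → Matching nC nF → Fin nC → Fin nF → Set
Blocks I M c f =
  acc I c f ≡ true ×
  M c ≢ just f ×
  (M c ≡ nothing ⊎ (∃ λ f' → M c ≡ just f' × crank I c f < crank I c f')) ×
  ((∀ c' → M c' ≢ just f) ⊎ (∃ λ c' → M c' ≡ just f × frank I f c < frank I f c'))

IsStable : ∀ {nC nF} → SMTI nC nF → Matching nC nF → Set
IsStable I M = IsMatching I M × (∀ c f → ¬ Blocks I M c f)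

maxOver : ∀ {n} → (Fin n → ℕ) → Subset n → ℕ
maxOver {zero}  g []      = 0
maxOver {suc n} g (b ∷ s) = (if b then g zero else 0) ⊔ maxOver (λ x → g (suc x)) s

-- If i were unmatched or matched worse than every family in 𝓕, then no j ∈ 𝓕
-- could block with i, so each j ∈ 𝓕 is matched to a child it ranks at least as
-- well as i, i.e. to a member of 𝓒 other than i.  Distinct families have
-- distinct partners, giving ∣𝓕∣ ≤ ∣𝓒 - i∣ < ∣𝓒∣, contrary to ∣𝓒∣ ≤ ∣𝓕∣.
module Submission where

open import Defs
open import Data.Nat using (ℕ; zero; suc; _≤_; _<_; z≤n; s≤s)
open import Data.Nat.Properties using (≤-refl; ≤-trans; ≤-<-trans; <-≤-trans; <-irrefl; m≤m⊔n; m≤n⊔m; _<?_; ≮⇒≥)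
open import Data.Bool using (true; if_then_else_)
open import Data.Fin using (Fin; zero; suc; _≟_)
open import Data.Fin.Subset using (Subset; inside; outside; _∈_; _-_; ∣_∣; Nonempty)
open import Data.Fin.Subset.Properties using (x∈p∧x≢y⇒x∈p-y; x∈p⇒∣p-x∣<∣p∣)
open import Data.Fin.Properties using (any?)
open import Data.Vec using ([]; _∷_; here; there)
open import Data.Maybe using (Maybe; just; nothing)
open import Data.Maybe.Properties using (≡-dec; just-injective)
open import Data.Product using (∃; _×_; _,_)
open import Data.Sum using (_⊎_; inj₁; inj₂)
open import Data.Empty using (⊥-elim)
open import Relation.Nullary using (¬_; yes; no)
open import Relation.Binary.PropositionalEquality using (_≡_; _≢_; refl; sym; trans)
open import Function.Bundles using (_⇔_; Equivalence)

∈⇒≤maxOver : ∀ {n} (g : Fin n → ℕ) (s : Subset n) {j} → j ∈ s → g j ≤ maxOver g s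
∈⇒≤maxOver g (inside ∷ s) here        = m≤m⊔n _ _
∈⇒≤maxOver g (b ∷ s)      (there j∈s) =
  ≤-trans (∈⇒≤maxOver (λ x → g (suc x)) s j∈s) (m≤n⊔m (if b then g zero else 0) _)

CoveredBy : ∀ {m n} → (Fin m → Maybe (Fin n)) → Subset m → Subset n → Set
CoveredBy f s p = ∀ {j} → j ∈ p → ∃ λ c → c ∈ s × f c ≡ just j

dropZero : ∀ {n} → Maybe (Fin (suc n)) → Maybe (Fin n)
dropZero (just (suc j)) = just j
dropZero _              = nothing

dropZero-suc : ∀ {n} {x : Maybe (Fin (suc n))} {j} → x ≡ just (suc j) → dropZero x ≡ just j
dropZero-suc refl = refl

coveredBy⇒∣p∣≤∣s∣ : ∀ {m n} (f : Fin m → Maybe (Fin n)) (s : Subset m) (p : Subset n) →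
                    CoveredBy f s p → ∣ p ∣ ≤ ∣ s ∣
coveredBy⇒∣p∣≤∣s∣ f s []            cover = z≤n
coveredBy⇒∣p∣≤∣s∣ f s (outside ∷ p) cover =
  coveredBy⇒∣p∣≤∣s∣ (λ c → dropZero (f c)) s p tail-covered
  where
  tail-covered : CoveredBy (λ c → dropZero (f c)) s p
  tail-covered j∈p with cover (there j∈p)
  ... | c , c∈s , fc≡ = c , c∈s , dropZero-suc fc≡
coveredBy⇒∣p∣≤∣s∣ f s (inside ∷ p)  cover with cover here
... | c₀ , c₀∈s , fc₀≡0 =
  <-≤-trans (s≤s (coveredBy⇒∣p∣≤∣s∣ (λ c → dropZero (f c)) (s - c₀) p tail-covered))
            (x∈p⇒∣p-x∣<∣p∣ c₀∈s)
  where
  tail-covered : CoveredBy (λ c → dropZero (f c)) (s - c₀) p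
  tail-covered j∈p with cover (there j∈p)
  ... | c , c∈s , fc≡ = c , x∈p∧x≢y⇒x∈p-y c∈s c≢c₀ , dropZero-suc fc≡
    where
    c≢c₀ : c ≢ c₀
    c≢c₀ refl with () ← just-injective (trans (sym fc≡) fc₀≡0)

module _ {nC nF} (I : SMTI nC nF) (M : Matching nC nF) where

  Improvement : Fin nC → Fin nF → Set
  Improvement c f = M c ≡ nothing ⊎ ∃ λ f' → M c ≡ just f' × crank I c f < crank I c f'

  improvement⇒not-matched : ∀ {c f} → Improvement c f → M c ≢ just f
  improvement⇒not-matched (inj₁ Mc≡nothing)          Mc≡f with () ← trans (sym Mc≡nothing) Mc≡f
  improvement⇒not-matched (inj₂ (f' , Mc≡f' , f<f')) Mc≡f
    with refl ← just-injective (trans (sym Mc≡f) Mc≡f') = <-irrefl refl f<f'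

  stable⇒weakly-prefers-partner : IsStable I M → ∀ {c f} → acc I c f ≡ true → Improvement c f →
                                  ∃ λ c' → M c' ≡ just f × frank I f c' ≤ frank I f c
  stable⇒weakly-prefers-partner (_ , unblocked) {c} {f} acc-cf improves
    with any? (λ c' → ≡-dec _≟_ (M c') (just f))
  ... | no f-unmatched =
    ⊥-elim (unblocked c f (acc-cf , improvement⇒not-matched improves , improves ,
                           inj₁ λ c' Mc'≡f → f-unmatched (c' , Mc'≡f)))
  ... | yes (c' , Mc'≡f) with frank I f c <? frank I f c'
  ...   | yes c<c' = ⊥-elim (unblocked c f (acc-cf , improvement⇒not-matched improves , improves ,
                                            inj₂ (c' , Mc'≡f , c<c')))
  ...   | no  c≮c' = c' , Mc'≡f , ≮⇒≥ c≮c'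

  not-all-improvements : IsStable I M → ∀ {i} {𝓕 : Subset nF} {𝓒 : Subset nC} →
    (∀ j → j ∈ 𝓕 → acc I i j ≡ true) →
    (∀ c j → j ∈ 𝓕 → acc I c j ≡ true → frank I j c ≤ frank I j i → c ∈ 𝓒) →
    i ∈ 𝓒 → ∣ 𝓒 ∣ ≤ ∣ 𝓕 ∣ →
    ¬ (∀ j → j ∈ 𝓕 → Improvement i j)
  not-all-improvements stable@((acc-M , _) , _) {i} {𝓕} {𝓒} acc-i 𝓒-closed i∈𝓒 ∣𝓒∣≤∣𝓕∣ improves =
    <-irrefl refl (≤-<-trans (≤-trans ∣𝓒∣≤∣𝓕∣ (coveredBy⇒∣p∣≤∣s∣ M (𝓒 - i) 𝓕 covered))
                             (x∈p⇒∣p-x∣<∣p∣ i∈𝓒))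
    where
    covered : CoveredBy M (𝓒 - i) 𝓕
    covered {j} j∈𝓕 with stable⇒weakly-prefers-partner stable (acc-i j j∈𝓕) (improves j j∈𝓕)
    ... | c , Mc≡j , c≤i = c , x∈p∧x≢y⇒x∈p-y c∈𝓒 c≢i , Mc≡j
      where
      c∈𝓒 : c ∈ 𝓒
      c∈𝓒 = 𝓒-closed c j j∈𝓕 (acc-M c j Mc≡j) c≤i

      c≢i : c ≢ i
      c≢i refl = improvement⇒not-matched (improves j j∈𝓕) Mc≡j

theorem1 : ∀ {nC nF} (I : SMTI nC nF) (i : Fin nC) (𝓕 : Subset nF) →
    Nonempty 𝓕 →
    (∀ j → j ∈ 𝓕 → acc I i j ≡ true) →
    (𝓒 : Subset nC) →
    (∀ i' → (i' ∈ 𝓒) ⇔ (∃ λ j → j ∈ 𝓕 × acc I i' j ≡ true × frank I j i' ≤ frank I j i)) →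
    ∣ 𝓒 ∣ ≤ ∣ 𝓕 ∣ →
    (M : Matching nC nF) → IsStable I M →
    ∃ λ j' → M i ≡ just j' × crank I i j' ≤ maxOver (crank I i) 𝓕
theorem1 I i 𝓕 (j₀ , j₀∈𝓕) acc-i 𝓒 𝓒-spec ∣𝓒∣≤∣𝓕∣ M stable = partner-within-bound
  where
  bound : ℕ
  bound = maxOver (crank I i) 𝓕

  𝓒-closed : ∀ c j → j ∈ 𝓕 → acc I c j ≡ true → frank I j c ≤ frank I j i → c ∈ 𝓒
  𝓒-closed c j j∈𝓕 acc-cj c≤i = Equivalence.from (𝓒-spec c) (j , j∈𝓕 , acc-cj , c≤i)

  not-all-improved : ¬ (∀ j → j ∈ 𝓕 → Improvement I M i j)
  not-all-improved = not-all-improvements I M stable acc-i 𝓒-closed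
                       (𝓒-closed i j₀ j₀∈𝓕 (acc-i j₀ j₀∈𝓕) ≤-refl) ∣𝓒∣≤∣𝓕∣

  partner-within-bound : ∃ λ j' → M i ≡ just j' × crank I i j' ≤ bound
  partner-within-bound with M i in Mi≡
  ... | nothing = ⊥-elim (not-all-improved λ _ _ → inj₁ Mi≡)
  ... | just j' with bound <? crank I i j'
  ...   | no  bound≮j' = j' , refl , ≮⇒≥ bound≮j'
  ...   | yes bound<j' = ⊥-elim (not-all-improved λ j j∈𝓕 →
            inj₂ (j' , Mi≡ , ≤-<-trans (∈⇒≤maxOver (crank I i) 𝓕 j∈𝓕) bound<j'))
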